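{- For all integers $n$ and $k$, $$h_{n+k+1}^2-q^{2k+1}h_{n-k}^2=d^2u_{2k+1}\left[\left(b^2-a^2q\right)u_{2n+1}-aq\left(2b-ap\right)u_{2n}\right].$$
   Context: Let $a,b,p,q$ be complex numbers with $q\neq 0$ and $p^2-4q\neq0$; $d^2=p^2-4q$. Sequences are indexed by $\mathbb{Z}$, extended to negative indices by solving the recurrence backwards. All satisfy $x_n=px_{n-1}-qx_{n-2}$, with initial values: $u_0=0,u_1=1$; Horadam-Lucas sequence $h_0=2b-ap$, $h_1=bp-2aq$. -}

module Defs where

open import Level using (Level)
open import Data.Nat using (ℕ; zero; suc)
open import Data.Integer using (ℤ; +_; -[1+_])
open import Data.Product using (_×_; _,_; proj₁; proj₂)
open import Algebra.Bundles using (CommutativeRing)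

-- All definitions are relative to a commutative ring R (the paper uses ℂ)
-- and parameters p, q together with a chosen inverse qinv of q.
module Seq {c ℓ : Level} (R : CommutativeRing c ℓ) where
  open CommutativeRing R

  pow : Carrier → ℕ → Carrier
  pow x zero    = 1#
  pow x (suc n) = x * pow x n

  zpow : (q qinv : Carrier) → ℤ → Carrier
  zpow q qinv (+ n)     = pow q n
  zpow q qinv -[1+ n ]  = pow qinv (suc n)

  fwd : (p q x0 x1 : Carrier) → ℕ → Carrier × Carrier
  fwd p q x0 x1 zero    = x0 , x1
  fwd p q x0 x1 (suc n) with fwd p q x0 x1 n
  ... | (a , b) = b , (p * b - q * a)

  -- backward pairs (x_{-(n+1)} , x_{-n}) for n ≥ 0,
  -- obtained by solving x_n = p x_{n-1} - q x_{n-2} for x_{n-2}: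
  -- x_{n-2} = (p x_{n-1} - x_n) q⁻¹
  bwd : (p qinv x0 x1 : Carrier) → ℕ → Carrier × Carrier
  bwd p qinv x0 x1 zero    = (p * x0 - x1) * qinv , x0
  bwd p qinv x0 x1 (suc n) with bwd p qinv x0 x1 n
  ... | (a , b) = (p * a - b) * qinv , a

  seq : (p q qinv x0 x1 : Carrier) → ℤ → Carrier
  seq p q qinv x0 x1 (+ n)     = proj₁ (fwd p q x0 x1 n)
  seq p q qinv x0 x1 -[1+ n ]  = proj₁ (bwd p qinv x0 x1 n)

  two four : Carrier
  two  = 1# + 1#
  four = two + two

  u : (p q qinv : Carrier) → ℤ → Carrier
  u p q qinv = seq p q qinv 0# 1#

  h : (a b p q qinv : Carrier) → ℤ → Carrier
  h a b p q qinv = seq p q qinv (two * b - a * p) (b * p - two * a * q)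

-- Every solution f of x_n = p x_{n-1} − q x_{n-2} obeys the addition formula
-- f_{m+j+1} = f_{m+1} u_{j+1} − q f_m u_j, and u_{j+1}² − p u_{j+1} u_j + q u_j² = q^j; since q is
-- invertible, a solution is determined by two consecutive terms, so both hold on all of ℤ.
-- With m = n − k and K = 2k they turn the left-hand side into u_{K+1} (u_{K+1} X − q u_K Y), where
-- X = h_{m+1}² − q h_m² and Y = h_m (2 h_{m+1} − p h_m). Expanding h, u_{2m−1}, u_{2m}, u_{2m+1} by
-- the addition formula makes X = d² g_{2m} and Y = d² g_{2m−1} polynomial identities in u_{m−1}, u_m,
-- where g_j = (b² − a²q) u_{j+1} − aq(2b − ap) u_j. Finally u_{K+1} g_{2m} − q u_K g_{2m−1} = g_{2n},
-- the addition formula once more, now for the solution g.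

module Submission where

open import Defs
open import Level using (Level)
open import Algebra.Bundles using (CommutativeRing)
open import Algebra.Solver.Ring.AlmostCommutativeRing
  using (fromCommutativeRing; _-Raw-AlmostCommutative⟶_)
open import Data.Integer as Z using (ℤ; +_; -[1+_]; 0ℤ; 1ℤ; -1ℤ; _⊖_; sign; ∣_∣)
open import Data.Integer.Tactic.RingSolver using (solve-∀)
import Data.Integer.Properties as Z
open import Data.Maybe.Base using (Maybe; just; nothing)
open import Data.Nat.Base as ℕ using (zero; suc)
import Data.Nat.Properties as ℕ
open import Data.Sign.Base as Sign using (Sign)
open import Relation.Nullary using (¬_)
open import Relation.Nullary.Decidable using (yes; no)
open import Relation.Binary.PropositionalEquality as ≡ using (_≡_)

-- Tactic.RingSolver takes its coefficients from the carrier itself and, lacking decidable equality,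
-- cannot cancel terms; normalising with coefficients in ℤ, which maps into every ring, can.
module IntegerCoefficients {c ℓ} (R : CommutativeRing c ℓ) where
  open CommutativeRing R
  open import Algebra.Properties.Semiring.Mult.TCOptimised semiring
    using (_×_; 1+×; ×-homo-+; ×1-homo-*)
  open import Algebra.Properties.AbelianGroup +-abelianGroup
    using (⁻¹-∙-comm; xyx⁻¹≈y; ε⁻¹≈ε; ⁻¹-involutive)
  open import Algebra.Properties.Ring ring using (-‿distribˡ-*; -‿distribʳ-*)
  open import Relation.Binary.Reasoning.Setoid setoid

  signed : Sign → Carrier → Carrier
  signed Sign.+ x = x
  signed Sign.- x = - x

  -- With the optimised multiple, con (+ 2) denotes 1# + 1#, which is Seq.two on the nose.
  fromℤ : ℤ → Carrier
  fromℤ i = signed (sign i) (∣ i ∣ × 1#)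

  signed-cong : ∀ s {x y} → x ≈ y → signed s x ≈ signed s y
  signed-cong Sign.+ x≈y = x≈y
  signed-cong Sign.- x≈y = -‿cong x≈y

  signed-* : ∀ s t x y → signed (s Sign.* t) (x * y) ≈ signed s x * signed t y
  signed-* Sign.+ Sign.+ x y = refl
  signed-* Sign.+ Sign.- x y = -‿distribʳ-* x y
  signed-* Sign.- Sign.+ x y = -‿distribˡ-* x y
  signed-* Sign.- Sign.- x y = begin
    x * y         ≈⟨ ⁻¹-involutive (x * y) ⟨
    - - (x * y)   ≈⟨ -‿cong (-‿distribˡ-* x y) ⟩
    - (- x * y)   ≈⟨ -‿distribʳ-* (- x) y ⟩
    - x * - y     ∎

  fromℤ-◃ : ∀ s n → fromℤ (s Z.◃ n) ≈ signed s (n × 1#)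
  fromℤ-◃ Sign.+ zero    = refl
  fromℤ-◃ Sign.- zero    = sym ε⁻¹≈ε
  fromℤ-◃ Sign.+ (suc n) = refl
  fromℤ-◃ Sign.- (suc n) = refl

  [x+y]-[x+z]≈y-z : ∀ x y z → (x + y) - (x + z) ≈ y - z
  [x+y]-[x+z]≈y-z x y z = begin
    (x + y) - (x + z)       ≈⟨ +-congˡ (⁻¹-∙-comm x z) ⟨
    (x + y) + (- x + - z)   ≈⟨ +-assoc (x + y) (- x) (- z) ⟨
    ((x + y) - x) - z       ≈⟨ +-congʳ (xyx⁻¹≈y x y) ⟩
    y - z                   ∎

  fromℤ-⊖ : ∀ m n → fromℤ (m ⊖ n) ≈ m × 1# - n × 1#
  fromℤ-⊖ m zero = begin
    m × 1#          ≈⟨ +-identityʳ (m × 1#) ⟨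
    m × 1# + 0#     ≈⟨ +-congˡ ε⁻¹≈ε ⟨
    m × 1# - 0#     ∎
  fromℤ-⊖ zero (suc n) = sym (+-identityˡ _)
  fromℤ-⊖ (suc m) (suc n) = begin
    fromℤ (suc m ⊖ suc n)          ≡⟨ ≡.cong fromℤ (Z.[1+m]⊖[1+n]≡m⊖n m n) ⟩
    fromℤ (m ⊖ n)                  ≈⟨ fromℤ-⊖ m n ⟩
    m × 1# - n × 1#                ≈⟨ [x+y]-[x+z]≈y-z 1# (m × 1#) (n × 1#) ⟨
    (1# + m × 1#) - (1# + n × 1#)  ≈⟨ +-cong (1+× m 1#) (-‿cong (1+× n 1#)) ⟨
    suc m × 1# - suc n × 1#        ∎

  fromℤ-+ : ∀ i j → fromℤ (i Z.+ j) ≈ fromℤ i + fromℤ j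
  fromℤ-+ (+ m)    (+ n)    = ×-homo-+ 1# m n
  fromℤ-+ (+ m)    -[1+ n ] = fromℤ-⊖ m (suc n)
  fromℤ-+ -[1+ m ] (+ n)    = trans (fromℤ-⊖ n (suc m)) (+-comm _ _)
  fromℤ-+ -[1+ m ] -[1+ n ] = begin
    - (suc (suc (m ℕ.+ n)) × 1#)        ≡⟨ ≡.cong (λ k → - (suc k × 1#)) (ℕ.+-suc m n) ⟨
    - ((suc m ℕ.+ suc n) × 1#)          ≈⟨ -‿cong (×-homo-+ 1# (suc m) (suc n)) ⟩
    - (suc m × 1# + suc n × 1#)         ≈⟨ ⁻¹-∙-comm (suc m × 1#) (suc n × 1#) ⟨
    - (suc m × 1#) + - (suc n × 1#)     ∎

  fromℤ-* : ∀ i j → fromℤ (i Z.* j) ≈ fromℤ i * fromℤ j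
  fromℤ-* i j = begin
    fromℤ (i Z.* j)                                ≈⟨ fromℤ-◃ (s Sign.* t) (∣ i ∣ ℕ.* ∣ j ∣) ⟩
    signed (s Sign.* t) ((∣ i ∣ ℕ.* ∣ j ∣) × 1#)   ≈⟨ signed-cong (s Sign.* t) (×1-homo-* ∣ i ∣ ∣ j ∣) ⟩
    signed (s Sign.* t) (∣ i ∣ × 1# * ∣ j ∣ × 1#)  ≈⟨ signed-* s t (∣ i ∣ × 1#) (∣ j ∣ × 1#) ⟩
    fromℤ i * fromℤ j                              ∎
    where
    s t : Sign
    s = sign i
    t = sign j

  fromℤ-neg : ∀ i → fromℤ (Z.- i) ≈ - fromℤ i
  fromℤ-neg (+ zero)  = sym ε⁻¹≈ε
  fromℤ-neg (+ suc n) = refl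
  fromℤ-neg -[1+ n ]  = sym (⁻¹-involutive _)

  fromℤ-homomorphism :
    CommutativeRing.rawRing Z.+-*-commutativeRing -Raw-AlmostCommutative⟶ fromCommutativeRing R
  fromℤ-homomorphism = record
    { ⟦_⟧ = fromℤ ; +-homo = fromℤ-+ ; *-homo = fromℤ-* ; -‿homo = fromℤ-neg
    ; 0-homo = refl ; 1-homo = refl }

  fromℤ-≟ : ∀ i j → Maybe (fromℤ i ≈ fromℤ j)
  fromℤ-≟ i j with i Z.≟ j
  ... | yes ≡.refl = just refl
  ... | no _       = nothing

  open import Algebra.Solver.Ring _ _ fromℤ-homomorphism fromℤ-≟ public

ℤ-induction : ∀ {p} (P : ℤ → Set p) → P 0ℤ → (∀ i → P i → P (Z.suc i)) → (∀ i → P (Z.suc i) → P i) →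
              ∀ i → P i
ℤ-induction P P0 up down (+ zero)      = P0
ℤ-induction P P0 up down (+ suc n)     = up (+ n) (ℤ-induction P P0 up down (+ n))
ℤ-induction P P0 up down -[1+ zero ]   = down -[1+ zero ] P0
ℤ-induction P P0 up down -[1+ suc n ]  = down -[1+ suc n ] (ℤ-induction P P0 up down -[1+ n ])

+-suc : ∀ m i → m Z.+ (1ℤ Z.+ i) ≡ 1ℤ Z.+ (m Z.+ i)
+-suc = solve-∀

n+k+1≡[n-k]+[1+2k] : ∀ n k → n Z.+ k Z.+ + 1 ≡ (n Z.- k) Z.+ (1ℤ Z.+ + 2 Z.* k)
n+k+1≡[n-k]+[1+2k] = solve-∀

2n≡[pred[n-k]+[n-k]]+[1+2k] : ∀ n k → + 2 Z.* n ≡ ((-1ℤ Z.+ (n Z.- k)) Z.+ (n Z.- k)) Z.+ (1ℤ Z.+ + 2 Z.* k)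
2n≡[pred[n-k]+[n-k]]+[1+2k] = solve-∀

module _ {c ℓ} (R : CommutativeRing c ℓ) where

  open CommutativeRing R
  open Seq R using (seq; pow; zpow; two; four)
  open IntegerCoefficients R
  open import Relation.Binary.Reasoning.Setoid setoid

  module LinearRecurrence (p q qinv : Carrier) (q*qinv≈1 : q * qinv ≈ 1#) where

    open import Data.Product.Base using (_×_; _,_; proj₁; proj₂)
    open import Algebra.Properties.CommutativeSemigroup *-commutativeSemigroup using (x∙yz≈y∙xz)

    IsSolution : (ℤ → Carrier) → Set ℓ
    IsSolution f = ∀ i → f (Z.suc (Z.suc i)) ≈ p * f (Z.suc i) - q * f i

    u : ℤ → Carrier
    u = Seq.u R p q qinv

    qinv*[q*x]≈x : ∀ x → qinv * (q * x) ≈ x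
    qinv*[q*x]≈x x = begin
      qinv * (q * x)   ≈⟨ solve 3 (λ q q⁻¹ x → q⁻¹ :* (q :* x) := (q :* q⁻¹) :* x) refl q qinv x ⟩
      (q * qinv) * x   ≈⟨ *-congʳ q*qinv≈1 ⟩
      1# * x           ≈⟨ *-identityˡ x ⟩
      x                ∎

    q*[qinv*x]≈x : ∀ x → q * (qinv * x) ≈ x
    q*[qinv*x]≈x x = trans (x∙yz≈y∙xz q qinv x) (qinv*[q*x]≈x x)

    q*[x*qinv]≈x : ∀ x → q * (x * qinv) ≈ x
    q*[x*qinv]≈x x = trans (*-congˡ (*-comm x qinv)) (q*[qinv*x]≈x x)

    *-cancelˡ-q : ∀ {x y} → q * x ≈ q * y → x ≈ y
    *-cancelˡ-q {x} {y} qx≈qy = begin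
      x                ≈⟨ qinv*[q*x]≈x x ⟨
      qinv * (q * x)   ≈⟨ *-congˡ qx≈qy ⟩
      qinv * (q * y)   ≈⟨ qinv*[q*x]≈x y ⟩
      y                ∎

    y-[y-x]≈x : ∀ x y → y - (y - x) ≈ x
    y-[y-x]≈x = solve 2 (λ x y → y :- (y :- x) := x) refl

    recurrence-backward : ∀ y z → z ≈ p * y - q * ((p * y - z) * qinv)
    recurrence-backward y z = begin
      z                                  ≈⟨ y-[y-x]≈x z (p * y) ⟨
      p * y - (p * y - z)                ≈⟨ +-congˡ (-‿cong (q*[x*qinv]≈x (p * y - z))) ⟨
      p * y - q * ((p * y - z) * qinv)   ∎

    seq-isSolution : ∀ x₀ x₁ → IsSolution (seq p q qinv x₀ x₁)
    seq-isSolution x₀ x₁ (+ n)              = refl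
    seq-isSolution x₀ x₁ -[1+ zero ]        = recurrence-backward _ _
    seq-isSolution x₀ x₁ -[1+ suc zero ]    = recurrence-backward _ _
    seq-isSolution x₀ x₁ -[1+ suc (suc n) ] = recurrence-backward _ _

    u-isSolution : IsSolution u
    u-isSolution = seq-isSolution 0# 1#

    solution-backward : ∀ {f} → IsSolution f → ∀ i → q * f i ≈ p * f (Z.suc i) - f (Z.suc (Z.suc i))
    solution-backward {f} f-sol i = begin
      q * f i                                        ≈⟨ y-[y-x]≈x (q * f i) (p * f (Z.suc i)) ⟨
      p * f (Z.suc i) - (p * f (Z.suc i) - q * f i)  ≈⟨ +-congˡ (-‿cong (f-sol i)) ⟨
      p * f (Z.suc i) - f (Z.suc (Z.suc i))          ∎

    solution-unique : ∀ {f g} → IsSolution f → IsSolution g → f 0ℤ ≈ g 0ℤ → f 1ℤ ≈ g 1ℤ →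
                      ∀ i → f i ≈ g i
    solution-unique {f} {g} f-sol g-sol f0≈g0 f1≈g1 i =
      proj₁ (ℤ-induction AgreeAt (f0≈g0 , f1≈g1) forward backward i)
      where
      AgreeAt : ℤ → Set ℓ
      AgreeAt i = f i ≈ g i × f (Z.suc i) ≈ g (Z.suc i)
      forward : ∀ i → AgreeAt i → AgreeAt (Z.suc i)
      forward i (fi≈gi , fi+1≈gi+1) = fi+1≈gi+1 , (begin
        f (Z.suc (Z.suc i))         ≈⟨ f-sol i ⟩
        p * f (Z.suc i) - q * f i   ≈⟨ +-cong (*-congˡ fi+1≈gi+1) (-‿cong (*-congˡ fi≈gi)) ⟩
        p * g (Z.suc i) - q * g i   ≈⟨ g-sol i ⟨
        g (Z.suc (Z.suc i))         ∎)
      backward : ∀ i → AgreeAt (Z.suc i) → AgreeAt i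
      backward i (fi+1≈gi+1 , fi+2≈gi+2) = *-cancelˡ-q (begin
        q * f i                                  ≈⟨ solution-backward f-sol i ⟩
        p * f (Z.suc i) - f (Z.suc (Z.suc i))    ≈⟨ +-cong (*-congˡ fi+1≈gi+1) (-‿cong fi+2≈gi+2) ⟩
        p * g (Z.suc i) - g (Z.suc (Z.suc i))    ≈⟨ solution-backward g-sol i ⟨
        q * g i                                  ∎) , fi+1≈gi+1

    IsGeometric : (ℤ → Carrier) → Set ℓ
    IsGeometric f = ∀ i → f (Z.suc i) ≈ q * f i

    geometric-unique : ∀ {f g} → IsGeometric f → IsGeometric g → f 0ℤ ≈ g 0ℤ → ∀ i → f i ≈ g i
    geometric-unique {f} {g} f-geo g-geo f0≈g0 = ℤ-induction (λ i → f i ≈ g i) f0≈g0 forward backward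
      where
      forward : ∀ i → f i ≈ g i → f (Z.suc i) ≈ g (Z.suc i)
      forward i fi≈gi = trans (f-geo i) (trans (*-congˡ fi≈gi) (sym (g-geo i)))
      backward : ∀ i → f (Z.suc i) ≈ g (Z.suc i) → f i ≈ g i
      backward i fi+1≈gi+1 = *-cancelˡ-q (trans (sym (f-geo i)) (trans fi+1≈gi+1 (g-geo i)))

    zpow-isGeometric : IsGeometric (zpow q qinv)
    zpow-isGeometric (+ n)           = refl
    zpow-isGeometric -[1+ zero ]     = sym (q*[qinv*x]≈x 1#)
    zpow-isGeometric -[1+ suc n ]    = sym (q*[qinv*x]≈x (pow qinv (suc n)))

    cassini : ∀ i → u (Z.suc i) * u (Z.suc i) - p * u (Z.suc i) * u i + q * (u i * u i) ≈ zpow q qinv i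
    cassini = geometric-unique C-isGeometric zpow-isGeometric C0≈1
      where
      C : ℤ → Carrier
      C i = u (Z.suc i) * u (Z.suc i) - p * u (Z.suc i) * u i + q * (u i * u i)
      C0≈1 : C 0ℤ ≈ 1#
      C0≈1 = solve 2 (λ p q → con 1ℤ :* con 1ℤ :- p :* con 1ℤ :* con 0ℤ :+ q :* (con 0ℤ :* con 0ℤ)
                             := con 1ℤ)
                     refl p q
      C-isGeometric : IsGeometric C
      C-isGeometric i = begin
        C (Z.suc i)
          ≈⟨ +-congʳ (+-cong (*-cong u-rec u-rec) (-‿cong (*-congʳ (*-congˡ u-rec)))) ⟩
        (p * y - q * x) * (p * y - q * x) - p * (p * y - q * x) * y + q * (y * y)
          ≈⟨ solve 4 (λ p q x y → (p :* y :- q :* x) :* (p :* y :- q :* x)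
                                    :- p :* (p :* y :- q :* x) :* y :+ q :* (y :* y)
                               := q :* (y :* y :- p :* y :* x :+ q :* (x :* x)))
                     refl p q x y ⟩
        q * C i ∎
        where
        x y : Carrier
        x = u i
        y = u (Z.suc i)
        u-rec : u (Z.suc (Z.suc i)) ≈ p * y - q * x
        u-rec = u-isSolution i

    shift-isSolution : ∀ {f} → IsSolution f → ∀ m → IsSolution (λ i → f (m Z.+ i))
    shift-isSolution {f} f-sol m i = begin
      f (m Z.+ Z.suc (Z.suc i))                         ≡⟨ ≡.cong f m+2+i≡2+m+i ⟩
      f (Z.suc (Z.suc (m Z.+ i)))                       ≈⟨ f-sol (m Z.+ i) ⟩
      p * f (Z.suc (m Z.+ i)) - q * f (m Z.+ i)         ≡⟨ ≡.cong (λ j → p * f j - q * f (m Z.+ i)) (+-suc m i) ⟨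
      p * f (m Z.+ Z.suc i) - q * f (m Z.+ i)           ∎
      where
      m+2+i≡2+m+i : m Z.+ Z.suc (Z.suc i) ≡ Z.suc (Z.suc (m Z.+ i))
      m+2+i≡2+m+i = ≡.trans (+-suc m (Z.suc i)) (≡.cong Z.suc (+-suc m i))

    combination-isSolution : ∀ {f g} → IsSolution f → IsSolution g →
                             ∀ α β → IsSolution (λ i → α * f i - β * g i)
    combination-isSolution {f} {g} f-sol g-sol α β i = begin
      α * f (Z.suc (Z.suc i)) - β * g (Z.suc (Z.suc i))
        ≈⟨ +-cong (*-congˡ (f-sol i)) (-‿cong (*-congˡ (g-sol i))) ⟩
      α * (p * f₁ - q * f₀) - β * (p * g₁ - q * g₀)
        ≈⟨ solve 8 (λ α β p q f₁ f₀ g₁ g₀ → α :* (p :* f₁ :- q :* f₀) :- β :* (p :* g₁ :- q :* g₀)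
                                         := p :* (α :* f₁ :- β :* g₁) :- q :* (α :* f₀ :- β :* g₀))
                   refl α β p q f₁ f₀ g₁ g₀ ⟩
      p * (α * f₁ - β * g₁) - q * (α * f₀ - β * g₀) ∎
      where
      f₀ f₁ g₀ g₁ : Carrier
      f₀ = f i
      f₁ = f (Z.suc i)
      g₀ = g i
      g₁ = g (Z.suc i)

    solution-addition : ∀ {f} → IsSolution f →
                        ∀ m i → f (m Z.+ Z.suc i) ≈ f (Z.suc m) * u (Z.suc i) - q * f m * u i
    solution-addition {f} f-sol m =
      solution-unique (shift-isSolution (shift-isSolution f-sol m) 1ℤ)
                      (combination-isSolution (shift-isSolution u-isSolution 1ℤ) u-isSolution
                                              (f (Z.suc m)) (q * f m))
                      at-0 at-1
      where
      at-0 : f (m Z.+ 1ℤ) ≈ f (Z.suc m) * 1# - q * f m * 0#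
      at-0 = begin
        f (m Z.+ 1ℤ)
          ≡⟨ ≡.cong f (Z.+-comm m 1ℤ) ⟩
        f (Z.suc m)
          ≈⟨ solve 2 (λ x y → x := x :* con 1ℤ :- y :* con 0ℤ) refl (f (Z.suc m)) (q * f m) ⟩
        f (Z.suc m) * 1# - q * f m * 0# ∎
      at-1 : f (m Z.+ + 2) ≈ f (Z.suc m) * (p * 1# - q * 0#) - q * f m * 1#
      at-1 = begin
        f (m Z.+ + 2)
          ≡⟨ ≡.cong f (≡.trans (+-suc m 1ℤ) (≡.cong Z.suc (Z.+-comm m 1ℤ))) ⟩
        f (Z.suc (Z.suc m))
          ≈⟨ f-sol m ⟩
        p * f (Z.suc m) - q * f m
          ≈⟨ solve 4 (λ p q x y → p :* x :- q :* y := x :* (p :* con 1ℤ :- q :* con 0ℤ) :- q :* y :* con 1ℤ)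
                     refl p q (f (Z.suc m)) (f m) ⟩
        f (Z.suc m) * (p * 1# - q * 0#) - q * f m * 1# ∎

  module HoradamLucas (a b p q qinv : Carrier) (q*qinv≈1 : q * qinv ≈ 1#) where

    open LinearRecurrence p q qinv q*qinv≈1

    h : ℤ → Carrier
    h = Seq.h R a b p q qinv

    h₀ h₁ D : Carrier
    h₀ = two * b - a * p
    h₁ = b * p - two * a * q
    D  = p * p - four * q

    h-isSolution : IsSolution h
    h-isSolution = seq-isSolution h₀ h₁

    -- The right-hand side of the theorem is d² u_{2k+1} g_{2n}.
    g : ℤ → Carrier
    g i = (b * b - a * a * q) * u (Z.suc i) - a * q * h₀ * u i

    g-isSolution : IsSolution g
    g-isSolution = combination-isSolution (shift-isSolution u-isSolution 1ℤ) u-isSolution _ _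

    square-difference-identity : ∀ x y → let z = p * y - q * x in
      (h₁ * z - q * h₀ * y) * (h₁ * z - q * h₀ * y) - q * ((h₁ * y - q * h₀ * x) * (h₁ * y - q * h₀ * x))
        ≈ D * ((b * b - a * a * q) * (z * z - q * y * y) - a * q * h₀ * (y * z - q * x * y))
    square-difference-identity x y = solve 6
      (λ a b p q x y →
        let H₀ = con (+ 2) :* b :- a :* p
            H₁ = b :* p :- con (+ 2) :* a :* q
            z  = p :* y :- q :* x
        in  (H₁ :* z :- q :* H₀ :* y) :* (H₁ :* z :- q :* H₀ :* y)
              :- q :* ((H₁ :* y :- q :* H₀ :* x) :* (H₁ :* y :- q :* H₀ :* x))
            := (p :* p :- (con (+ 2) :+ con (+ 2)) :* q)
                 :* ((b :* b :- a :* a :* q) :* (z :* z :- q :* y :* y) :- a :* q :* H₀ :* (y :* z :- q :* x :* y)))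
      refl a b p q x y

    cross-identity : ∀ x y → let z = p * y - q * x in
      (h₁ * y - q * h₀ * x) * (two * (h₁ * z - q * h₀ * y) - p * (h₁ * y - q * h₀ * x))
        ≈ D * ((b * b - a * a * q) * (y * z - q * x * y) - a * q * h₀ * (y * y - q * x * x))
    cross-identity x y = solve 6
      (λ a b p q x y →
        let H₀ = con (+ 2) :* b :- a :* p
            H₁ = b :* p :- con (+ 2) :* a :* q
            z  = p :* y :- q :* x
        in  (H₁ :* y :- q :* H₀ :* x) :* (con (+ 2) :* (H₁ :* z :- q :* H₀ :* y) :- p :* (H₁ :* y :- q :* H₀ :* x))
            := (p :* p :- (con (+ 2) :+ con (+ 2)) :* q)
                 :* ((b :* b :- a :* a :* q) :* (y :* z :- q :* x :* y) :- a :* q :* H₀ :* (y :* y :- q :* x :* x)))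
      refl a b p q x y

    module Expansions (s : ℤ) where
      x y : Carrier
      x = u s
      y = u (Z.suc s)

      u-2+s : u (Z.suc (Z.suc s)) ≈ p * y - q * x
      u-2+s = u-isSolution s

      h-1+s : h (Z.suc s) ≈ h₁ * y - q * h₀ * x
      h-1+s = trans (reflexive (≡.cong h (≡.sym (Z.+-identityˡ (Z.suc s)))))
                    (solution-addition h-isSolution 0ℤ s)

      h-2+s : h (Z.suc (Z.suc s)) ≈ h₁ * (p * y - q * x) - q * h₀ * y
      h-2+s = trans (reflexive (≡.cong h (≡.sym (Z.+-identityˡ (Z.suc (Z.suc s))))))
                    (trans (solution-addition h-isSolution 0ℤ (Z.suc s)) (+-congʳ (*-congˡ u-2+s)))

      u-1+2s : u (s Z.+ Z.suc s) ≈ y * y - q * x * x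
      u-1+2s = solution-addition u-isSolution s s

      u-2+2s : u (Z.suc (s Z.+ Z.suc s)) ≈ y * (p * y - q * x) - q * x * y
      u-2+2s = trans (reflexive (≡.cong u (≡.sym (+-suc s (Z.suc s)))))
                     (trans (solution-addition u-isSolution s (Z.suc s)) (+-congʳ (*-congˡ u-2+s)))

      u-3+2s : u (Z.suc (Z.suc (s Z.+ Z.suc s))) ≈ (p * y - q * x) * (p * y - q * x) - q * y * y
      u-3+2s = trans (reflexive (≡.cong u (3+2s≡[1+s]+[2+s] s)))
                     (trans (solution-addition u-isSolution (Z.suc s) (Z.suc s)) (+-congʳ (*-cong u-2+s u-2+s)))
        where
        3+2s≡[1+s]+[2+s] : ∀ s → 1ℤ Z.+ (1ℤ Z.+ (s Z.+ (1ℤ Z.+ s))) ≡ (1ℤ Z.+ s) Z.+ (1ℤ Z.+ (1ℤ Z.+ s))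
        3+2s≡[1+s]+[2+s] = solve-∀

    h-square-difference : ∀ s →
      h (Z.suc (Z.suc s)) * h (Z.suc (Z.suc s)) - q * (h (Z.suc s) * h (Z.suc s)) ≈ D * g (Z.suc (s Z.+ Z.suc s))
    h-square-difference s =
      trans (+-cong (*-cong h-2+s h-2+s) (-‿cong (*-congˡ (*-cong h-1+s h-1+s))))
            (trans (square-difference-identity x y)
                   (*-congˡ (sym (+-cong (*-congˡ u-3+2s) (-‿cong (*-congˡ u-2+2s))))))
      where open Expansions s

    h-cross : ∀ s →
      h (Z.suc s) * (two * h (Z.suc (Z.suc s)) - p * h (Z.suc s)) ≈ D * g (s Z.+ Z.suc s)
    h-cross s =
      trans (*-cong h-1+s (+-cong (*-congˡ h-2+s) (-‿cong (*-congˡ h-1+s))))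
            (trans (cross-identity x y)
                   (*-congˡ (sym (+-cong (*-congˡ u-2+2s) (-‿cong (*-congˡ u-1+2s))))))
      where open Expansions s

    product-factorisation : ∀ A B U₁ U₀ →
      (A * U₁ - q * B * U₀) * (A * U₁ - q * B * U₀) - q * (U₁ * U₁ - p * U₁ * U₀ + q * (U₀ * U₀)) * (B * B)
        ≈ U₁ * (U₁ * (A * A - q * (B * B)) - q * U₀ * (B * (two * A - p * B)))
    product-factorisation A B U₁ U₀ = solve 6
      (λ p q A B U₁ U₀ →
        (A :* U₁ :- q :* B :* U₀) :* (A :* U₁ :- q :* B :* U₀)
          :- q :* (U₁ :* U₁ :- p :* U₁ :* U₀ :+ q :* (U₀ :* U₀)) :* (B :* B)
        := U₁ :* (U₁ :* (A :* A :- q :* (B :* B)) :- q :* U₀ :* (B :* (con (+ 2) :* A :- p :* B))))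
      refl p q A B U₁ U₀

    horadam-core : ∀ s K →
      h (Z.suc s Z.+ Z.suc K) * h (Z.suc s Z.+ Z.suc K) - zpow q qinv (Z.suc K) * (h (Z.suc s) * h (Z.suc s))
        ≈ D * (u (Z.suc K) * g ((s Z.+ Z.suc s) Z.+ Z.suc K))
    horadam-core s K = begin
      h (Z.suc s Z.+ Z.suc K) * h (Z.suc s Z.+ Z.suc K) - zpow q qinv (Z.suc K) * (B * B)
        ≈⟨ +-cong (*-cong h-sum h-sum) (-‿cong (*-congʳ q-power)) ⟩
      (A * U₁ - q * B * U₀) * (A * U₁ - q * B * U₀) - q * (U₁ * U₁ - p * U₁ * U₀ + q * (U₀ * U₀)) * (B * B)
        ≈⟨ product-factorisation A B U₁ U₀ ⟩
      U₁ * (U₁ * (A * A - q * (B * B)) - q * U₀ * (B * (two * A - p * B)))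
        ≈⟨ *-congˡ (+-cong (*-congˡ (h-square-difference s)) (-‿cong (*-congˡ (h-cross s)))) ⟩
      U₁ * (U₁ * (D * g (Z.suc m)) - q * U₀ * (D * g m))
        ≈⟨ solve 6 (λ D q U₁ U₀ G₁ G₀ → U₁ :* (U₁ :* (D :* G₁) :- q :* U₀ :* (D :* G₀))
                                      := D :* (U₁ :* (G₁ :* U₁ :- q :* G₀ :* U₀)))
                   refl D q U₁ U₀ (g (Z.suc m)) (g m) ⟩
      D * (U₁ * (g (Z.suc m) * U₁ - q * g m * U₀))
        ≈⟨ *-congˡ (*-congˡ (solution-addition g-isSolution m K)) ⟨
      D * (U₁ * g (m Z.+ Z.suc K)) ∎
      where
      m : ℤ
      m = s Z.+ Z.suc s
      A B U₁ U₀ : Carrier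
      A  = h (Z.suc (Z.suc s))
      B  = h (Z.suc s)
      U₁ = u (Z.suc K)
      U₀ = u K
      h-sum : h (Z.suc s Z.+ Z.suc K) ≈ A * U₁ - q * B * U₀
      h-sum = solution-addition h-isSolution (Z.suc s) K
      q-power : zpow q qinv (Z.suc K) ≈ q * (U₁ * U₁ - p * U₁ * U₀ + q * (U₀ * U₀))
      q-power = trans (zpow-isGeometric K) (*-congˡ (sym (cassini K)))

    horadam-identity : ∀ n k →
      h (n Z.+ k Z.+ + 1) * h (n Z.+ k Z.+ + 1) - zpow q qinv (+ 2 Z.* k Z.+ + 1) * (h (n Z.- k) * h (n Z.- k))
        ≈ D * (u (+ 2 Z.* k Z.+ + 1) * ((b * b - a * a * q) * u (+ 2 Z.* n Z.+ + 1) - a * q * h₀ * u (+ 2 Z.* n)))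
    horadam-identity n k = begin
      h (n Z.+ k Z.+ + 1) * h (n Z.+ k Z.+ + 1) - zpow q qinv (+ 2 Z.* k Z.+ + 1) * (h (n Z.- k) * h (n Z.- k))
        ≈⟨ +-cong (*-cong h-sum h-sum) (-‿cong (*-cong q-power (*-cong h-diff h-diff))) ⟩
      h (Z.suc s Z.+ Z.suc K) * h (Z.suc s Z.+ Z.suc K) - zpow q qinv (Z.suc K) * (h (Z.suc s) * h (Z.suc s))
        ≈⟨ horadam-core s K ⟩
      D * (u (Z.suc K) * g ((s Z.+ Z.suc s) Z.+ Z.suc K))
        ≈⟨ *-congˡ (*-cong u-odd g-even) ⟨
      D * (u (+ 2 Z.* k Z.+ + 1) * g (+ 2 Z.* n))
        ≡⟨ ≡.cong (λ i → D * (u (+ 2 Z.* k Z.+ + 1) * ((b * b - a * a * q) * u i - a * q * h₀ * u (+ 2 Z.* n))))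
                  (Z.+-comm 1ℤ (+ 2 Z.* n)) ⟩
      D * (u (+ 2 Z.* k Z.+ + 1) * ((b * b - a * a * q) * u (+ 2 Z.* n Z.+ + 1) - a * q * h₀ * u (+ 2 Z.* n))) ∎
      where
      s K : ℤ
      s = Z.pred (n Z.- k)
      K = + 2 Z.* k
      n-k≡1+s : n Z.- k ≡ Z.suc s
      n-k≡1+s = ≡.sym (Z.suc-pred (n Z.- k))
      h-sum : h (n Z.+ k Z.+ + 1) ≈ h (Z.suc s Z.+ Z.suc K)
      h-sum = reflexive (≡.cong h (≡.trans (n+k+1≡[n-k]+[1+2k] n k) (≡.cong (Z._+ Z.suc K) n-k≡1+s)))
      h-diff : h (n Z.- k) ≈ h (Z.suc s)
      h-diff = reflexive (≡.cong h n-k≡1+s)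
      q-power : zpow q qinv (+ 2 Z.* k Z.+ + 1) ≈ zpow q qinv (Z.suc K)
      q-power = reflexive (≡.cong (zpow q qinv) (Z.+-comm K 1ℤ))
      u-odd : u (+ 2 Z.* k Z.+ + 1) ≈ u (Z.suc K)
      u-odd = reflexive (≡.cong u (Z.+-comm K 1ℤ))
      g-even : g (+ 2 Z.* n) ≈ g ((s Z.+ Z.suc s) Z.+ Z.suc K)
      g-even = reflexive (≡.cong g (≡.trans (2n≡[pred[n-k]+[n-k]]+[1+2k] n k)
                                            (≡.cong (λ j → (s Z.+ j) Z.+ Z.suc K) n-k≡1+s)))

mainTheorem14 : ∀ {c ℓ : Level} (R : CommutativeRing c ℓ) →
    let open CommutativeRing R in
    let open Seq R in
    (a b p q qinv d : Carrier) →
    q * qinv ≈ 1# →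
    ¬ ((p * p) - (four * q) ≈ 0#) →
    d * d ≈ (p * p) - (four * q) →
    (n k : ℤ) →
    (h a b p q qinv (n Z.+ k Z.+ + 1) * h a b p q qinv (n Z.+ k Z.+ + 1))
      - (zpow q qinv (+ 2 Z.* k Z.+ + 1) * (h a b p q qinv (n Z.- k) * h a b p q qinv (n Z.- k)))
    ≈ (d * d) * (u p q qinv (+ 2 Z.* k Z.+ + 1) *
        ((((b * b) - ((a * a) * q)) * u p q qinv (+ 2 Z.* n Z.+ + 1))
          - (((a * q) * ((two * b) - (a * p))) * u p q qinv (+ 2 Z.* n))))
mainTheorem14 R a b p q qinv d q*qinv≈1 _ d²≈D n k =
  trans (horadam-identity n k) (*-congʳ (sym d²≈D))
  where
  open CommutativeRing R
  open HoradamLucas R a b p q qinv q*qinv≈1
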